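{- Let $p$ be a prime with $p\equiv 1\pmod 4$ and for an integer $n\ge 0$ define $$F(n)=4^{p-1}\prod_{\substack{j=0\\ j\neq \frac{p-1}{4}}}^{p-1}(1+4j+4np)^2\prod_{i=0}^{p-2}\frac{1}{(1+i+np)^2}.$$ Then the residue of $F(n)$ modulo $p^2$ is independent of $n$; that is, $F(n)\equiv F(m)\pmod{p^2}$ for all integers $n,m\ge 0$.
   Context: $F(n)$ is a rational number whose denominator is prime to $p$. For such rationals $x,y$, $x\equiv y\pmod{p^k}$ means that $x-y$, in lowest terms, has numerator divisible by $p^k$. -}

module Defs where

open import Data.Nat as ℕ using (ℕ; zero; suc; _+_; _*_; _∸_; _^_; _≡ᵇ_; _/_)
open import Data.Bool using (if_then_else_)
open import Data.Integer as ℤ using (ℤ; +_)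
open import Data.Integer.Divisibility using () renaming (_∣_ to _∣ℤ_)
open import Data.Rational as ℚ using (ℚ; ↥_)

∏< : ℕ → (ℕ → ℚ) → ℚ
∏< zero    f = ℚ.1ℚ
∏< (suc k) f = ∏< k f ℚ.* f k

ℕ→ℚ : ℕ → ℚ
ℕ→ℚ m = (+ m) ℚ./ 1

sq : ℚ → ℚ
sq x = x ℚ.* x

F : ℕ → ℕ → ℚ
F p n =
  (ℕ→ℚ (4 ^ (p ∸ 1)))
  ℚ.* ∏< p (λ j → if j ≡ᵇ ((p ∸ 1) / 4) then ℚ.1ℚ
                    else sq (ℕ→ℚ (1 + 4 * j + 4 * n * p)))
  ℚ.* ∏< (p ∸ 1) (λ i → sq ((+ 1) ℚ./ suc (i + n * p)))

_≡_[modℚ_] : ℚ → ℚ → ℕ → Set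
x ≡ y [modℚ m ] = (+ m) ∣ℤ (↥ (x ℚ.- y))

-- Write p = 4q + 1.  Both products in F(n) have the shape ∏ᵢ (fᵢ + x·wᵢ) with x a multiple
-- of p (x = 4np, resp. x = np).  Expanding to first order in x,
--     ∏ᵢ (fᵢ + x·wᵢ) = ∏ᵢ fᵢ + x · slope(f, w) + x² · R,   slope(f, w) = Σᵢ wᵢ ∏_{j≠i} fⱼ,
-- so the product is independent of n modulo p² as soon as p divides the slope.
--   * Denominator, fᵢ = i + 1 (i < 4q), wᵢ = 1: shifting every factor by -p turns
--     ∏ (i+1) into ∏ (-(4q-i)) = (4q)!, the same product, which forces p ∣ slope.
--   * Numerator, fⱼ = 1 + 4j (j < p, j ≠ q), weight 4: modulo p, 1 + 4j ≡ 4·gⱼ where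
--     g runs through 1, …, 4q in rotated order, so the slope reduces to the denominator case.
-- Finally F(n) = A(n)/B(n) with A, B integers that are constant modulo p² and p ∤ B(n);
-- cross-multiplying shows p² divides the numerator of F(n) - F(m).

module Submission where

open import Defs
open import Data.Nat using (ℕ; _^_; _%_)
open import Data.Nat.Primality using (Prime)
open import Relation.Binary.PropositionalEquality using (_≡_)

open import Data.Nat as ℕ using (zero; suc; _<_; _∸_; _/_; _≡ᵇ_; _!)
import Data.Nat.Properties as ℕP
import Data.Nat.DivMod as ℕDM
open import Data.Nat.Divisibility as ℕD using (_∣_; divides)
open import Data.Nat.Primality using (euclidsLemma; prime⇒nonZero; ¬prime[1])
open import Data.Integer as ℤ using (ℤ; +_; _+_; _*_; -_; _-_)
import Data.Integer.Properties as ℤP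
open import Data.Rational as ℚ using (ℚ; mkℚ; toℚᵘ)
import Data.Rational.Properties as ℚP
open import Data.Rational.Unnormalised as ℚᵘ using (ℚᵘ; mkℚᵘ; _≃_; *≡*)
import Data.Rational.Unnormalised.Properties as ℚᵘP
open import Data.Bool using (true; false; if_then_else_)
open import Data.Product using (Σ; _,_)
open import Data.Sum using (inj₁; inj₂)
open import Relation.Binary.Definitions using (tri<; tri≈; tri>)
open import Relation.Nullary using (¬_; contradiction)
open import Relation.Nullary.Decidable using (dec-true; dec-false)
open import Relation.Binary.PropositionalEquality
  using (refl; sym; trans; cong; cong₂; subst; subst₂; module ≡-Reasoning)
open import Data.Integer.Tactic.RingSolver using (solve-∀)
import Data.Nat.Tactic.RingSolver as ℕRing

infix 4 _≋_[mod_]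

record _≋_[mod_] (a b m : ℤ) : Set where
  constructor ≋-by
  field
    multiple : ℤ
    differ   : a ≡ b + multiple * m

≋-reflexive : ∀ {a b m} → a ≡ b → a ≋ b [mod m ]
≋-reflexive {a} {m = m} refl = ≋-by (+ 0) (h a m)
  where h : ∀ a m → a ≡ a + + 0 * m
        h = solve-∀

≋-sym : ∀ {a b m} → a ≋ b [mod m ] → b ≋ a [mod m ]
≋-sym {b = b} {m} (≋-by k refl) = ≋-by (- k) (h b k m)
  where h : ∀ b k m → b ≡ b + k * m + - k * m
        h = solve-∀

≋-trans : ∀ {a b c m} → a ≋ b [mod m ] → b ≋ c [mod m ] → a ≋ c [mod m ]
≋-trans {c = c} {m = m} (≋-by k refl) (≋-by l refl) = ≋-by (l + k) (h c l k m)
  where h : ∀ c l k m → c + l * m + k * m ≡ c + (l + k) * m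
        h = solve-∀

≋-+ : ∀ {a b c d m} → a ≋ b [mod m ] → c ≋ d [mod m ] → a + c ≋ b + d [mod m ]
≋-+ {b = b} {d = d} {m} (≋-by k refl) (≋-by l refl) = ≋-by (k + l) (h b d k l m)
  where h : ∀ b d k l m → b + k * m + (d + l * m) ≡ b + d + (k + l) * m
        h = solve-∀

≋-* : ∀ {a b c d m} → a ≋ b [mod m ] → c ≋ d [mod m ] → a * c ≋ b * d [mod m ]
≋-* {b = b} {d = d} {m} (≋-by k refl) (≋-by l refl) = ≋-by (b * l + k * d + k * l * m) (h b d k l m)
  where h : ∀ b d k l m → (b + k * m) * (d + l * m) ≡ b * d + (b * l + k * d + k * l * m) * m
        h = solve-∀

≋-*-zero : ∀ c {a m} → a ≋ + 0 [mod m ] → c * a ≋ + 0 [mod m ]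
≋-*-zero c {m = m} (≋-by k refl) = ≋-by (c * k) (h c k m)
  where h : ∀ c k m → c * (+ 0 + k * m) ≡ + 0 + c * k * m
        h = solve-∀

≋-from-ℕ : ∀ a b k m → a ≡ b ℕ.+ k ℕ.* m → + a ≋ + b [mod + m ]
≋-from-ℕ a b k m refl = ≋-by (+ k) (trans (ℤP.pos-+ b (k ℕ.* m)) (cong (λ t → + b + t) (ℤP.pos-* k m)))

≋-from-ℕ⁻ : ∀ a b k m → a ℕ.+ k ℕ.* m ≡ b → + a ≋ + b [mod + m ]
≋-from-ℕ⁻ a b k m e = ≋-sym (≋-from-ℕ b a k m (sym e))

-- Products and their slopes

∏ : ℕ → (ℕ → ℤ) → ℤ
∏ zero    f = + 1
∏ (suc k) f = ∏ k f * f k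

-- slope k f w = Σ_{i<k} w i · ∏_{j≠i} f j, the coefficient of x in ∏_{i<k} (f i + x · w i).
slope : ℕ → (ℕ → ℤ) → (ℕ → ℤ) → ℤ
slope zero    f w = + 0
slope (suc k) f w = slope k f w * f k + ∏ k f * w k

∏-ext : ∀ k {f g} → (∀ i → i < k → f i ≡ g i) → ∏ k f ≡ ∏ k g
∏-ext zero    eq = refl
∏-ext (suc k) eq = cong₂ _*_ (∏-ext k (λ i i<k → eq i (ℕP.m<n⇒m<1+n i<k))) (eq k (ℕP.n<1+n k))

slope-ext : ∀ k {f g w v} → (∀ i → i < k → f i ≡ g i) → (∀ i → i < k → w i ≡ v i) →
  slope k f w ≡ slope k g v
slope-ext zero    eqf eqw = refl
slope-ext (suc k) eqf eqw = cong₂ _+_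
  (cong₂ _*_ (slope-ext k (below eqf) (below eqw)) (eqf k (ℕP.n<1+n k)))
  (cong₂ _*_ (∏-ext k (below eqf)) (eqw k (ℕP.n<1+n k)))
  where below : ∀ {f g : ℕ → ℤ} → (∀ i → i < suc k → f i ≡ g i) → ∀ i → i < k → f i ≡ g i
        below eq i i<k = eq i (ℕP.m<n⇒m<1+n i<k)

∏-split : ∀ a b f → ∏ (a ℕ.+ b) f ≡ ∏ a f * ∏ b (λ i → f (a ℕ.+ i))
∏-split a zero    f rewrite ℕP.+-identityʳ a = sym (ℤP.*-identityʳ (∏ a f))
∏-split a (suc b) f rewrite ℕP.+-suc a b | ∏-split a b f = ℤP.*-assoc (∏ a f) _ _

slope-split : ∀ a b f w → slope (a ℕ.+ b) f w ≡
  slope a f w * ∏ b (λ i → f (a ℕ.+ i)) + ∏ a f * slope b (λ i → f (a ℕ.+ i)) (λ i → w (a ℕ.+ i))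
slope-split a zero f w rewrite ℕP.+-identityʳ a = h (slope a f w) (∏ a f)
  where h : ∀ s p → s ≡ s * + 1 + p * + 0
        h = solve-∀
slope-split a (suc b) f w rewrite ℕP.+-suc a b | slope-split a b f w | ∏-split a b f =
  h (slope a f w) (∏ a f) (∏ b (λ i → f (a ℕ.+ i))) (slope b (λ i → f (a ℕ.+ i)) (λ i → w (a ℕ.+ i)))
    (f (a ℕ.+ b)) (w (a ℕ.+ b))
  where h : ∀ s p pb sb x y → (s * pb + p * sb) * x + p * pb * y ≡ s * (pb * x) + p * (sb * x + pb * y)
        h = solve-∀

∏-head : ∀ k f → ∏ (suc k) f ≡ f 0 * ∏ k (λ i → f (suc i))
∏-head k f = trans (∏-split 1 k f) (cong (_* ∏ k (λ i → f (suc i))) (ℤP.*-identityˡ (f 0)))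

slope-head : ∀ k f w → w 0 ≡ + 0 → slope (suc k) f w ≡ f 0 * slope k (λ i → f (suc i)) (λ i → w (suc i))
slope-head k f w w₀ = begin
  slope (suc k) f w
    ≡⟨ slope-split 1 k f w ⟩
  (+ 0 * f 0 + + 1 * w 0) * ∏ k f′ + + 1 * f 0 * slope k f′ w′
    ≡⟨ cong (λ z → (+ 0 * f 0 + + 1 * z) * ∏ k f′ + + 1 * f 0 * slope k f′ w′) w₀ ⟩
  (+ 0 * f 0 + + 1 * + 0) * ∏ k f′ + + 1 * f 0 * slope k f′ w′
    ≡⟨ h (f 0) (∏ k f′) (slope k f′ w′) ⟩
  f 0 * slope k f′ w′ ∎
  where
    open ≡-Reasoning
    f′ w′ : ℕ → ℤ
    f′ i = f (suc i)
    w′ i = w (suc i)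
    h : ∀ a p s → (+ 0 * a + + 1 * + 0) * p + + 1 * a * s ≡ a * s
    h = solve-∀

∏-scale : ∀ k c f → ∏ k (λ i → c * f i) ≡ c ℤ.^ k * ∏ k f
∏-scale zero    c f = refl
∏-scale (suc k) c f rewrite ∏-scale k c f = h (c ℤ.^ k) (∏ k f) c (f k)
  where h : ∀ ck p c x → ck * p * (c * x) ≡ c * ck * (p * x)
        h = solve-∀

slope-scale : ∀ k c f w → slope k (λ i → c * f i) (λ i → c * w i) ≡ c ℤ.^ k * slope k f w
slope-scale zero    c f w = h (c ℤ.^ 0)
  where h : ∀ a → + 0 ≡ a * + 0
        h = solve-∀
slope-scale (suc k) c f w rewrite slope-scale k c f w | ∏-scale k c f =
  h (c ℤ.^ k) (slope k f w) (∏ k f) c (f k) (w k)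
  where h : ∀ ck s p c x y → ck * s * (c * x) + ck * p * (c * y) ≡ c * ck * (s * x + p * y)
        h = solve-∀

∏-mul : ∀ k f g → ∏ k (λ i → f i * g i) ≡ ∏ k f * ∏ k g
∏-mul zero    f g = refl
∏-mul (suc k) f g rewrite ∏-mul k f g = h (∏ k f) (∏ k g) (f k) (g k)
  where h : ∀ a b c d → a * b * (c * d) ≡ a * c * (b * d)
        h = solve-∀

∏-one : ∀ k → ∏ k (λ _ → + 1) ≡ + 1
∏-one zero    = refl
∏-one (suc k) rewrite ∏-one k = refl

∏-cong : ∀ k {f g m} → (∀ i → f i ≋ g i [mod m ]) → ∏ k f ≋ ∏ k g [mod m ]
∏-cong zero    eq = ≋-reflexive refl
∏-cong (suc k) eq = ≋-* (∏-cong k eq) (eq k)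

slope-cong : ∀ k {f g w v m} → (∀ i → f i ≋ g i [mod m ]) → (∀ i → w i ≋ v i [mod m ]) →
  slope k f w ≋ slope k g v [mod m ]
slope-cong zero    eqf eqw = ≋-reflexive refl
slope-cong (suc k) eqf eqw = ≋-+ (≋-* (slope-cong k eqf eqw) (eqf k)) (≋-* (∏-cong k eqf) (eqw k))

∏-linear : ∀ k f w x → Σ ℤ λ R → ∏ k (λ i → f i + x * w i) ≡ ∏ k f + x * slope k f w + x * x * R
∏-linear zero    f w x = + 0 , h x
  where h : ∀ x → + 1 ≡ + 1 + x * + 0 + x * x * + 0
        h = solve-∀
∏-linear (suc k) f w x with ∏-linear k f w x
... | R , eq = R * f k + slope k f w * w k + x * R * w k ,
  trans (cong (_* (f k + x * w k)) eq) (h (∏ k f) (slope k f w) R (f k) (w k) x)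
  where h : ∀ P S R a b x → (P + x * S + x * x * R) * (a + x * b)
              ≡ P * a + x * (S * a + P * b) + x * x * (R * a + S * b + x * R * b)
        h = solve-∀

∏-stable : ∀ k f w m N → slope k f w ≋ + 0 [mod m ] →
  ∏ k (λ i → f i + (m * N) * w i) ≋ ∏ k f [mod m * m ]
∏-stable k f w m N (≋-by c eqS) with ∏-linear k f w (m * N)
... | R , eqL = ≋-by (N * c + N * N * R)
  (trans eqL (trans (cong (λ s → ∏ k f + m * N * s + m * N * (m * N) * R) eqS) (h (∏ k f) m N c R)))
  where h : ∀ A m N c R → A + m * N * (+ 0 + c * m) + m * N * (m * N) * R ≡ A + (N * c + N * N * R) * (m * m)
        h = solve-∀

slope-divisible : ∀ k f w x .{{_ : ℤ.NonZero x}} →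
  ∏ k (λ i → f i + (- x) * w i) ≡ ∏ k f → slope k f w ≋ + 0 [mod x ]
slope-divisible k f w x unchanged with ∏-linear k f w (- x)
... | R , eqL = ≋-by R (trans S≡xR (h₀ x R))
  where
    S = slope k f w
    A = ∏ k f
    h₁ : ∀ A x S R → x * S ≡ x * (x * R) + (A - (A + (- x) * S + (- x) * (- x) * R))
    h₁ = solve-∀
    h₂ : ∀ A x R → x * (x * R) + (A - A) ≡ x * (x * R)
    h₂ = solve-∀
    h₀ : ∀ x R → x * R ≡ + 0 + R * x
    h₀ = solve-∀
    xS≡xxR : x * S ≡ x * (x * R)
    xS≡xxR = trans (h₁ A x S R) (trans (cong (λ t → x * (x * R) + (A - t)) (trans (sym eqL) unchanged)) (h₂ A x R))
    S≡xR : S ≡ x * R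
    S≡xR = ℤP.*-cancelˡ-≡ x S (x * R) xS≡xxR

-- The slope of 1, 2, …, 2r vanishes modulo 2r + 1

∏-ascending : ∀ k → ∏ k (λ i → + suc i) ≡ + (k !)
∏-ascending zero    = refl
∏-ascending (suc k) rewrite ∏-ascending k =
  trans (sym (ℤP.pos-* (k !) (suc k))) (cong +_ (ℕP.*-comm (k !) (suc k)))

∏-descending : ∀ k → ∏ k (λ i → + (k ∸ i)) ≡ + (k !)
∏-descending zero    = refl
∏-descending (suc k) = begin
  ∏ (suc k) (λ i → + (suc k ∸ i))   ≡⟨ ∏-head k (λ i → + (suc k ∸ i)) ⟩
  + suc k * ∏ k (λ i → + (k ∸ i))   ≡⟨ cong (+ suc k *_) (∏-descending k) ⟩
  + suc k * + (k !)                 ≡⟨ sym (ℤP.pos-* (suc k) (k !)) ⟩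
  + (suc k !)                       ∎
  where open ≡-Reasoning

reflect-factor : ∀ k i → i < k → + suc i + (- + suc k) * + 1 ≡ - + (k ∸ i)
reflect-factor k i i<k = begin
  + suc i + (- + suc k) * + 1   ≡⟨ cong (λ t → + suc i + t) (ℤP.*-identityʳ (- + suc k)) ⟩
  + suc i + (- + suc k)         ≡⟨ ℤP.m-n≡m⊖n (suc i) (suc k) ⟩
  suc i ℤ.⊖ suc k               ≡⟨ ℤP.⊖-swap (suc i) (suc k) ⟩
  - (suc k ℤ.⊖ suc i)           ≡⟨ cong -_ (ℤP.⊖-≥ (ℕP.m<n⇒m<1+n i<k)) ⟩
  - + (k ∸ i)                   ∎
  where open ≡-Reasoning

-- The elementary symmetric function e_{2r-1}(1, …, 2r) is divisible by 2r + 1: the product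
-- (1 - (2r+1)) ⋯ (2r - (2r+1)) = (-1)^{2r} (2r)! equals 1 ⋯ 2r, so slope-divisible applies.
consecutive-slope : ∀ r → slope (2 ℕ.* r) (λ i → + suc i) (λ _ → + 1) ≋ + 0 [mod + suc (2 ℕ.* r) ]
consecutive-slope r = slope-divisible k B (λ _ → + 1) (+ suc k) (begin
  ∏ k (λ i → B i + (- + suc k) * + 1)   ≡⟨ ∏-ext k (reflect-factor k) ⟩
  ∏ k (λ i → - + (k ∸ i))                ≡⟨ ∏-ext k (λ i _ → sym (ℤP.-1*i≡-i (+ (k ∸ i)))) ⟩
  ∏ k (λ i → - + 1 * + (k ∸ i))          ≡⟨ ∏-scale k (- + 1) (λ i → + (k ∸ i)) ⟩
  (- + 1) ℤ.^ k * ∏ k (λ i → + (k ∸ i))  ≡⟨ cong₂ _*_ even-power (trans (∏-descending k) (sym (∏-ascending k))) ⟩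
  + 1 * ∏ k B                            ≡⟨ ℤP.*-identityˡ (∏ k B) ⟩
  ∏ k B                                  ∎)
  where
    open ≡-Reasoning
    k = 2 ℕ.* r
    B : ℕ → ℤ
    B i = + suc i
    even-power : (- + 1) ℤ.^ k ≡ + 1
    even-power = trans (sym (ℤP.^-*-assoc (- + 1) 2 r)) (ℤP.^-zeroˡ r)

-- Fractions by cross-multiplication

infix 4 _≐_÷_

record _≐_÷_ (u : ℚᵘ) (a b : ℤ) : Set where
  constructor cross
  field
    cross-multiplied : ℚᵘ.↥ u * b ≡ a * ℚᵘ.↧ u

≐-transport : ∀ {u v a b} → u ≃ v → v ≐ a ÷ b → u ≐ a ÷ b
≐-transport {u} {v@(mkℚᵘ _ _)} {a} {b} (*≡* uv) (cross vab) =
  cross (ℤP.*-cancelʳ-≡ (ℚᵘ.↥ u * b) (a * ℚᵘ.↧ u) (ℚᵘ.↧ v) (begin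
    ℚᵘ.↥ u * b * ℚᵘ.↧ v    ≡⟨ h (ℚᵘ.↥ u) b (ℚᵘ.↧ v) ⟩
    ℚᵘ.↥ u * ℚᵘ.↧ v * b    ≡⟨ cong (_* b) uv ⟩
    ℚᵘ.↥ v * ℚᵘ.↧ u * b    ≡⟨ h (ℚᵘ.↥ v) (ℚᵘ.↧ u) b ⟩
    ℚᵘ.↥ v * b * ℚᵘ.↧ u    ≡⟨ cong (_* ℚᵘ.↧ u) vab ⟩
    a * ℚᵘ.↧ v * ℚᵘ.↧ u    ≡⟨ h a (ℚᵘ.↧ v) (ℚᵘ.↧ u) ⟩
    a * ℚᵘ.↧ u * ℚᵘ.↧ v    ∎))
  where
    open ≡-Reasoning
    h : ∀ x y z → x * y * z ≡ x * z * y
    h = solve-∀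

-- Unnormalised products and differences are computed factorwise, so no cancellation is needed.
≐-*ᵘ : ∀ {u v a b c d} → u ≐ a ÷ b → v ≐ c ÷ d → u ℚᵘ.* v ≐ a * c ÷ (b * d)
≐-*ᵘ {mkℚᵘ n₁ e₁} {mkℚᵘ n₂ e₂} {a} {b} {c} {d} (cross r₁) (cross r₂) = cross (begin
  n₁ * n₂ * (b * d)                ≡⟨ h n₁ n₂ b d ⟩
  n₁ * b * (n₂ * d)                ≡⟨ cong₂ _*_ r₁ r₂ ⟩
  a * + suc e₁ * (c * + suc e₂)    ≡⟨ h a (+ suc e₁) c (+ suc e₂) ⟩
  a * c * (+ suc e₁ * + suc e₂)    ∎)
  where
    open ≡-Reasoning
    h : ∀ x y z w → x * y * (z * w) ≡ x * z * (y * w)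
    h = solve-∀

≐-subᵘ : ∀ {u v a b c d} → u ≐ a ÷ b → v ≐ c ÷ d → u ℚᵘ.- v ≐ a * d - c * b ÷ (b * d)
≐-subᵘ {mkℚᵘ n₁ e₁} {mkℚᵘ n₂ e₂} {a} {b} {c} {d} (cross r₁) (cross r₂) = cross (begin
  (n₁ * E₂ + (- n₂) * E₁) * (b * d)      ≡⟨ h₁ n₁ n₂ E₁ E₂ b d ⟩
  n₁ * b * (E₂ * d) - n₂ * d * (E₁ * b)  ≡⟨ cong₂ (λ s t → s * (E₂ * d) - t * (E₁ * b)) r₁ r₂ ⟩
  a * E₁ * (E₂ * d) - c * E₂ * (E₁ * b)  ≡⟨ h₂ a c E₁ E₂ b d ⟩
  (a * d - c * b) * (E₁ * E₂)            ∎)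
  where
    open ≡-Reasoning
    E₁ = + suc e₁
    E₂ = + suc e₂
    h₁ : ∀ n₁ n₂ E₁ E₂ b d → (n₁ * E₂ + (- n₂) * E₁) * (b * d) ≡ n₁ * b * (E₂ * d) - n₂ * d * (E₁ * b)
    h₁ = solve-∀
    h₂ : ∀ a c E₁ E₂ b d → a * E₁ * (E₂ * d) - c * E₂ * (E₁ * b) ≡ (a * d - c * b) * (E₁ * E₂)
    h₂ = solve-∀

≐-/ : ∀ n d → toℚᵘ (n ℚ./ suc d) ≐ n ÷ + suc d
≐-/ n d = ≐-transport (ℚP.toℚᵘ-fromℚᵘ (mkℚᵘ n d)) (cross refl)

≐-* : ∀ x y {a b c d} → toℚᵘ x ≐ a ÷ b → toℚᵘ y ≐ c ÷ d → toℚᵘ (x ℚ.* y) ≐ a * c ÷ (b * d)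
≐-* x y r₁ r₂ = ≐-transport (ℚP.toℚᵘ-homo-* x y) (≐-*ᵘ r₁ r₂)

≐-- : ∀ x y {a b c d} → toℚᵘ x ≐ a ÷ b → toℚᵘ y ≐ c ÷ d → toℚᵘ (x ℚ.- y) ≐ a * d - c * b ÷ (b * d)
≐-- x y r₁ r₂ = ≐-transport
  (ℚᵘP.≃-trans (ℚP.toℚᵘ-homo-+ x (ℚ.- y)) (ℚᵘP.+-congʳ (toℚᵘ x) (ℚP.toℚᵘ-homo‿- y)))
  (≐-subᵘ r₁ r₂)

≐-ℚ : ∀ {z a b} → toℚᵘ z ≐ a ÷ b → ℚ.↥ z * b ≡ a * ℚ.↧ z
≐-ℚ {mkℚ _ _ _} (cross e) = e

≐-∏< : ∀ k f a b → (∀ i → toℚᵘ (f i) ≐ a i ÷ b i) → toℚᵘ (∏< k f) ≐ ∏ k a ÷ ∏ k b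
≐-∏< zero    f a b r = ≐-/ (+ 1) 0
≐-∏< (suc k) f a b r = ≐-* (∏< k f) (f k) (≐-∏< k f a b r) (r k)

∤-* : ∀ {p m n} → Prime p → ¬ p ∣ m → ¬ p ∣ n → ¬ p ∣ m ℕ.* n
∤-* {m = m} {n} pr p∤m p∤n p∣mn with euclidsLemma m n pr p∣mn
... | inj₁ p∣m = p∤m p∣m
... | inj₂ p∣n = p∤n p∣n

∤-∏ : ∀ {p} → Prime p → ∀ k f → (∀ i → i < k → ¬ p ∣ ℤ.∣ f i ∣) → ¬ p ∣ ℤ.∣ ∏ k f ∣
∤-∏ pr zero    f p∤f p∣1 = ¬prime[1] (subst Prime (ℕD.∣1⇒≡1 p∣1) pr)
∤-∏ pr (suc k) f p∤f p∣∏ = ∤-* pr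
  (∤-∏ pr k f (λ i i<k → p∤f i (ℕP.m<n⇒m<1+n i<k))) (p∤f k (ℕP.n<1+n k))
  (subst (_ ∣_) (ℤP.abs-* (∏ k f) (f k)) p∣∏)

prime-power-cancel : ∀ {p} → Prime p → ∀ k {u v} → ¬ p ∣ v → p ^ k ∣ u ℕ.* v → p ^ k ∣ u
prime-power-cancel pr zero {u} _ _ = ℕD.1∣ u
prime-power-cancel {p} pr (suc k) {u} {v} p∤v pᵏ⁺¹∣uv
  with euclidsLemma u v pr (ℕD.∣-trans (ℕD.m∣m*n (p ^ k)) pᵏ⁺¹∣uv)
... | inj₂ p∣v = contradiction p∣v p∤v
... | inj₁ (divides r refl) =
  subst (p ^ suc k ∣_) (ℕP.*-comm p r) (ℕD.*-monoʳ-∣ p (prime-power-cancel pr k p∤v pᵏ∣rv))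
  where
    instance
      p≢0 : ℕ.NonZero p
      p≢0 = prime⇒nonZero pr
    pᵏ∣rv : p ^ k ∣ r ℕ.* v
    pᵏ∣rv = ℕD.*-cancelˡ-∣ p (subst (p ^ suc k ∣_) (trans (ℕP.*-assoc r p v) (h r p v)) pᵏ⁺¹∣uv)
      where h : ∀ r p v → r ℕ.* (p ℕ.* v) ≡ p ℕ.* (r ℕ.* v)
            h = ℕRing.solve-∀

fraction-congruence : ∀ {p} k x y {a b c d} → Prime p →
  toℚᵘ x ≐ a ÷ b → toℚᵘ y ≐ c ÷ d → a ≋ c [mod + (p ^ k) ] → b ≋ d [mod + (p ^ k) ] →
  ¬ p ∣ ℤ.∣ b ∣ → ¬ p ∣ ℤ.∣ d ∣ → x ≡ y [modℚ p ^ k ]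
fraction-congruence {p} k x y {a} {b} {c} {d} pr rx ry a≋c b≋d p∤b p∤d =
  prime-power-cancel pr k (∤-* pr p∤b p∤d) (divides (ℤ.∣ K ∣ ℕ.* ℤ.∣ ↧ ∣) (begin
    ℤ.∣ ↥ ∣ ℕ.* (ℤ.∣ b ∣ ℕ.* ℤ.∣ d ∣)       ≡⟨ cong (ℤ.∣ ↥ ∣ ℕ.*_) (ℤP.abs-* b d) ⟨
    ℤ.∣ ↥ ∣ ℕ.* ℤ.∣ b * d ∣              ≡⟨ ℤP.abs-* ↥ (b * d) ⟨
    ℤ.∣ ↥ * (b * d) ∣                 ≡⟨ cong ℤ.∣_∣ cross-eq ⟩
    ℤ.∣ K * + (p ^ k) * ↧ ∣            ≡⟨ ℤP.abs-* (K * + (p ^ k)) ↧ ⟩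
    ℤ.∣ K * + (p ^ k) ∣ ℕ.* ℤ.∣ ↧ ∣       ≡⟨ cong (ℕ._* ℤ.∣ ↧ ∣) (ℤP.abs-* K (+ (p ^ k))) ⟩
    ℤ.∣ K ∣ ℕ.* p ^ k ℕ.* ℤ.∣ ↧ ∣         ≡⟨ h ℤ.∣ K ∣ (p ^ k) ℤ.∣ ↧ ∣ ⟩
    ℤ.∣ K ∣ ℕ.* ℤ.∣ ↧ ∣ ℕ.* p ^ k         ∎))
  where
    open ≡-Reasoning
    ↥ ↧ : ℤ
    ↥ = ℚ.↥ (x ℚ.- y)
    ↧ = ℚ.↧ (x ℚ.- y)
    ad≋cb : a * d ≋ c * b [mod + (p ^ k) ]
    ad≋cb = ≋-* a≋c (≋-sym b≋d)
    K = _≋_[mod_].multiple ad≋cb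
    difference : ∀ s t k m → s ≡ t + k * m → s - t ≡ k * m
    difference s t k m refl = h′ t k m
      where h′ : ∀ t k m → t + k * m - t ≡ k * m
            h′ = solve-∀
    cross-eq : ↥ * (b * d) ≡ K * + (p ^ k) * ↧
    cross-eq = trans (≐-ℚ (≐-- x y rx ry))
      (cong (_* ↧) (difference (a * d) (c * b) K (+ (p ^ k)) (_≋_[mod_].differ ad≋cb)))
    h : ∀ s t u → s ℕ.* t ℕ.* u ≡ s ℕ.* u ℕ.* t
    h = ℕRing.solve-∀

-- F(n) as a fraction of integers

numerator-base : ℕ → ℕ → ℕ → ℕ
numerator-base p n j = 1 ℕ.+ 4 ℕ.* j ℕ.+ 4 ℕ.* n ℕ.* p

denominator-base : ℕ → ℕ → ℕ → ℕ
denominator-base p n i = suc (i ℕ.+ n ℕ.* p)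

numerator-factor : ℕ → ℕ → ℕ → ℕ → ℤ
numerator-factor p J n j =
  if j ≡ᵇ J then + 1 else + numerator-base p n j * + numerator-base p n j

numer : ℕ → ℕ → ℤ
numer p n = + (4 ^ (p ∸ 1)) * ∏ p (numerator-factor p ((p ∸ 1) / 4) n)

denom : ℕ → ℕ → ℤ
denom p n = ∏ (p ∸ 1) (λ i → + denominator-base p n i * + denominator-base p n i)

F-fraction : ∀ p n → toℚᵘ (F p n) ≐ numer p n ÷ denom p n
F-fraction p n = subst₂ (toℚᵘ (F p n) ≐_÷_) numer≡ denom≡
  (≐-* _ _ (≐-* _ _ (≐-/ (+ (4 ^ (p ∸ 1))) 0) (≐-∏< p _ _ (λ _ → + 1) numerator-part))
           (≐-∏< (p ∸ 1) _ (λ _ → + 1) _ denominator-part))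
  where
    J = (p ∸ 1) / 4
    numerator-part : ∀ j → toℚᵘ (if j ≡ᵇ J then ℚ.1ℚ else sq (ℕ→ℚ (numerator-base p n j)))
      ≐ (if j ≡ᵇ J then + 1 else + numerator-base p n j * + numerator-base p n j) ÷ + 1
    numerator-part j with j ≡ᵇ J
    ... | true  = ≐-/ (+ 1) 0
    ... | false = ≐-* _ _ (≐-/ (+ numerator-base p n j) 0) (≐-/ (+ numerator-base p n j) 0)
    denominator-part : ∀ i → toℚᵘ (sq ((+ 1) ℚ./ denominator-base p n i))
      ≐ + 1 ÷ (+ denominator-base p n i * + denominator-base p n i)
    denominator-part i = ≐-* _ _ (≐-/ (+ 1) (i ℕ.+ n ℕ.* p)) (≐-/ (+ 1) (i ℕ.+ n ℕ.* p))
    numer≡ : + (4 ^ (p ∸ 1)) * ∏ p (numerator-factor p J n) * ∏ (p ∸ 1) (λ _ → + 1) ≡ numer p n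
    numer≡ = trans (cong (numer p n *_) (∏-one (p ∸ 1))) (ℤP.*-identityʳ (numer p n))
    denom≡ : + 1 * ∏ p (λ _ → + 1) * denom p n ≡ denom p n
    denom≡ = trans (cong (λ t → + 1 * t * denom p n) (∏-one p)) (ℤP.*-identityˡ (denom p n))

≡ᵇ-refl : ∀ j → (j ≡ᵇ j) ≡ true
≡ᵇ-refl j = dec-true (j ℕ.≟ j) refl

≡ᵇ-≢ : ∀ {i j} → ¬ i ≡ j → (i ≡ᵇ j) ≡ false
≡ᵇ-≢ {i} {j} i≢j = dec-false (i ℕ.≟ j) i≢j

-- The case p = 4q + 1

module OneModFour (q : ℕ) (p-prime : Prime (suc (4 ℕ.* q))) where

  p : ℕ
  p = suc (4 ℕ.* q)

  P : ℤ
  P = + p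

  B one : ℕ → ℤ
  B i   = + suc i
  one _ = + 1

  denominator-slope : slope (4 ℕ.* q) B one ≋ + 0 [mod P ]
  denominator-slope = subst (λ k → slope k B one ≋ + 0 [mod + suc k ])
    (sym (ℕP.*-assoc 2 2 q)) (consecutive-slope (2 ℕ.* q))

  skip fN wN : ℕ → ℤ
  skip j = if j ≡ᵇ q then + 0 else + 1
  fN j   = if j ≡ᵇ q then + 1 else + suc (4 ℕ.* j)
  wN j   = + 4 * skip j

  -- Modulo p, fN j ≡ 4 · g j, where g lists 3q+1, …, 4q, then 3q+1 (at j = q), then 1, …, 3q.
  g : ℕ → ℕ
  g j with ℕP.<-cmp j q
  ... | tri< _ _ _ = suc (3 ℕ.* q ℕ.+ j)
  ... | tri≈ _ _ _ = suc (3 ℕ.* q)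
  ... | tri> _ _ _ = j ∸ q

  fN≋4g : ∀ j → fN j ≋ + (4 ℕ.* g j) [mod P ]
  fN≋4g j with ℕP.<-cmp j q
  ... | tri< j<q _ _ rewrite ≡ᵇ-≢ (ℕP.<⇒≢ j<q) =
    ≋-from-ℕ⁻ (suc (4 ℕ.* j)) (4 ℕ.* suc (3 ℕ.* q ℕ.+ j)) 3 p (h q j)
    where h : ∀ q j → suc (4 ℕ.* j) ℕ.+ 3 ℕ.* suc (4 ℕ.* q) ≡ 4 ℕ.* suc (3 ℕ.* q ℕ.+ j)
          h = ℕRing.solve-∀
  ... | tri≈ _ refl _ rewrite ≡ᵇ-refl j =
    ≋-from-ℕ⁻ 1 (4 ℕ.* suc (3 ℕ.* j)) 3 p (h j)
    where h : ∀ q → 1 ℕ.+ 3 ℕ.* suc (4 ℕ.* q) ≡ 4 ℕ.* suc (3 ℕ.* q)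
          h = ℕRing.solve-∀
  ... | tri> _ _ q<j rewrite ≡ᵇ-≢ (ℕP.>⇒≢ q<j) =
    ≋-from-ℕ (suc (4 ℕ.* j)) (4 ℕ.* (j ∸ q)) 1 p
      (subst (λ t → suc (4 ℕ.* t) ≡ 4 ℕ.* (j ∸ q) ℕ.+ 1 ℕ.* p) (ℕP.m+[n∸m]≡n (ℕP.<⇒≤ q<j)) (h q (j ∸ q)))
    where h : ∀ q d → suc (4 ℕ.* (q ℕ.+ d)) ≡ 4 ℕ.* d ℕ.+ 1 ℕ.* suc (4 ℕ.* q)
          h = ℕRing.solve-∀

  g-below : ∀ i → i < q → g i ≡ suc (3 ℕ.* q ℕ.+ i)
  g-below i i<q with ℕP.<-cmp i q
  ... | tri< _ _ _   = refl
  ... | tri≈ i≮q _ _ = contradiction i<q i≮q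
  ... | tri> i≮q _ _ = contradiction i<q i≮q

  g-at : g q ≡ suc (3 ℕ.* q)
  g-at with ℕP.<-cmp q q
  ... | tri< _ q≢q _ = contradiction refl q≢q
  ... | tri≈ _ _ _   = refl
  ... | tri> _ q≢q _ = contradiction refl q≢q

  g-above : ∀ i → g (q ℕ.+ suc i) ≡ suc i
  g-above i with ℕP.<-cmp (q ℕ.+ suc i) q
  ... | tri< _ _ q≮ = contradiction (ℕP.m<m+n q (ℕ.s≤s ℕ.z≤n)) q≮
  ... | tri≈ _ _ q≮ = contradiction (ℕP.m<m+n q (ℕ.s≤s ℕ.z≤n)) q≮
  ... | tri> _ _ _  = ℕP.m+n∸m≡n q (suc i)

  skip-at : skip q ≡ + 0
  skip-at rewrite ≡ᵇ-refl q = refl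

  skip-off : ∀ {i} → ¬ i ≡ q → skip i ≡ + 1
  skip-off i≢q rewrite ≡ᵇ-≢ i≢q = refl

  -- Rotating g back to 1, …, 4q: the slope of (g, skip) is (3q+1) times the denominator slope.
  slope-rotated : slope p (λ j → + g j) skip ≡ + suc (3 ℕ.* q) * slope (4 ℕ.* q) B one
  slope-rotated = begin
    slope p G skip
      ≡⟨ cong (λ k → slope k G skip) (h₁ q) ⟩
    slope (q ℕ.+ suc t) G skip
      ≡⟨ slope-split q (suc t) G skip ⟩
    slope q G skip * ∏ (suc t) G↑ + ∏ q G * slope (suc t) G↑ skip↑
      ≡⟨ cong₂ _+_ (cong₂ _*_ first-slope tail-∏) (cong₂ _*_ first-∏ tail-slope) ⟩
    slope q B↑ one * (u * ∏ t B) + ∏ q B↑ * (u * slope t B one)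
      ≡⟨ h₂ (slope q B↑ one) (∏ q B↑) (slope t B one) (∏ t B) u ⟩
    u * (slope t B one * ∏ q B↑ + ∏ t B * slope q B↑ one)
      ≡⟨ cong (u *_) (slope-split t q B one) ⟨
    u * slope (t ℕ.+ q) B one
      ≡⟨ cong (λ k → u * slope k B one) (ℕP.+-comm t q) ⟩
    u * slope (4 ℕ.* q) B one ∎
    where
      open ≡-Reasoning
      t = 3 ℕ.* q
      u = + suc t
      G B↑ G↑ skip↑ : ℕ → ℤ
      G j = + g j
      B↑ i = B (t ℕ.+ i)
      G↑ i = G (q ℕ.+ i)
      skip↑ i = skip (q ℕ.+ i)
      G↑₀ : G↑ 0 ≡ u
      G↑₀ = cong +_ (trans (cong g (ℕP.+-identityʳ q)) g-at)
      first-slope : slope q G skip ≡ slope q B↑ one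
      first-slope = slope-ext q (λ i i<q → cong +_ (g-below i i<q)) (λ i i<q → skip-off (ℕP.<⇒≢ i<q))
      first-∏ : ∏ q G ≡ ∏ q B↑
      first-∏ = ∏-ext q (λ i i<q → cong +_ (g-below i i<q))
      tail-∏ : ∏ (suc t) G↑ ≡ u * ∏ t B
      tail-∏ = trans (∏-head t G↑) (cong₂ _*_ G↑₀ (∏-ext t (λ i _ → cong +_ (g-above i))))
      tail-slope : slope (suc t) G↑ skip↑ ≡ u * slope t B one
      tail-slope = trans (slope-head t G↑ skip↑ (trans (cong skip (ℕP.+-identityʳ q)) skip-at))
        (cong₂ _*_ G↑₀ (slope-ext t (λ i _ → cong +_ (g-above i))
          (λ i _ → skip-off (ℕP.>⇒≢ (ℕP.m<m+n q (ℕ.s≤s ℕ.z≤n))))))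
      h₁ : ∀ q → suc (4 ℕ.* q) ≡ q ℕ.+ suc (3 ℕ.* q)
      h₁ = ℕRing.solve-∀
      h₂ : ∀ s π s′ π′ u → s * (u * π′) + π * (u * s′) ≡ u * (s′ * π + π′ * s)
      h₂ = solve-∀

  numerator-slope : slope p fN wN ≋ + 0 [mod P ]
  numerator-slope = ≋-trans
    (slope-cong p (λ j → subst (fN j ≋_[mod P ]) (ℤP.pos-* 4 (g j)) (fN≋4g j)) (λ _ → ≋-reflexive refl))
    (subst (_≋ + 0 [mod P ]) (sym scaled) (≋-*-zero ((+ 4) ℤ.^ p * u) denominator-slope))
    where
      u = + suc (3 ℕ.* q)
      scaled : slope p (λ j → + 4 * + g j) wN ≡ (+ 4) ℤ.^ p * u * slope (4 ℕ.* q) B one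
      scaled = begin
        slope p (λ j → + 4 * + g j) wN                  ≡⟨ slope-scale p (+ 4) (λ j → + g j) skip ⟩
        (+ 4) ℤ.^ p * slope p (λ j → + g j) skip          ≡⟨ cong ((+ 4) ℤ.^ p *_) slope-rotated ⟩
        (+ 4) ℤ.^ p * (u * slope (4 ℕ.* q) B one)         ≡⟨ ℤP.*-assoc ((+ 4) ℤ.^ p) u _ ⟨
        (+ 4) ℤ.^ p * u * slope (4 ℕ.* q) B one           ∎
        where open ≡-Reasoning

  quarter : (p ∸ 1) / 4 ≡ q
  quarter = trans (cong (_/ 4) (ℕP.*-comm 4 q)) (ℕDM.m*n/n≡m q 4)

  numerator-root : ∀ n j b →
    (if b then + 1 else + numerator-base p n j * + numerator-base p n j)
      ≡ ((if b then + 1 else + suc (4 ℕ.* j)) + (P * + n) * (+ 4 * (if b then + 0 else + 1)))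
      * ((if b then + 1 else + suc (4 ℕ.* j)) + (P * + n) * (+ 4 * (if b then + 0 else + 1)))
  numerator-root n j true  = h (P * + n)
    where h : ∀ x → + 1 ≡ (+ 1 + x * (+ 4 * + 0)) * (+ 1 + x * (+ 4 * + 0))
          h = solve-∀
  numerator-root n j false = cong₂ _*_ root root
    where
      h : ∀ n P → + 4 * n * P ≡ P * n * (+ 4 * + 1)
      h = solve-∀
      root : + numerator-base p n j ≡ + suc (4 ℕ.* j) + (P * + n) * (+ 4 * + 1)
      root = trans (ℤP.pos-+ (suc (4 ℕ.* j)) (4 ℕ.* n ℕ.* p)) (cong (λ t → + suc (4 ℕ.* j) + t)
        (trans (ℤP.pos-* (4 ℕ.* n) p) (trans (cong (_* P) (ℤP.pos-* 4 n)) (h (+ n) P))))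

  numerator-stable : ∀ n → numer p n ≋ + (4 ^ (p ∸ 1)) * (∏ p fN * ∏ p fN) [mod P * P ]
  numerator-stable n = subst (_≋ _ [mod P * P ]) (sym numer≡)
    (≋-* (≋-reflexive {+ (4 ^ (p ∸ 1))} refl) (≋-* stable stable))
    where
      H : ℕ → ℤ
      H j = fN j + (P * + n) * wN j
      stable : ∏ p H ≋ ∏ p fN [mod P * P ]
      stable = ∏-stable p fN wN P (+ n) numerator-slope
      numer≡ : numer p n ≡ + (4 ^ (p ∸ 1)) * (∏ p H * ∏ p H)
      numer≡ = cong (+ (4 ^ (p ∸ 1)) *_) (begin
        ∏ p (numerator-factor p ((p ∸ 1) / 4) n) ≡⟨ cong (λ J → ∏ p (numerator-factor p J n)) quarter ⟩
        ∏ p (numerator-factor p q n)             ≡⟨ ∏-ext p (λ j _ → numerator-root n j (j ≡ᵇ q)) ⟩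
        ∏ p (λ j → H j * H j)                    ≡⟨ ∏-mul p H H ⟩
        ∏ p H * ∏ p H                            ∎)
        where open ≡-Reasoning

  denominator-stable : ∀ n → denom p n ≋ ∏ (4 ℕ.* q) B * ∏ (4 ℕ.* q) B [mod P * P ]
  denominator-stable n = subst (_≋ _ [mod P * P ]) (sym denom≡) (≋-* stable stable)
    where
      E : ℕ → ℤ
      E i = B i + (P * + n) * one i
      stable : ∏ (4 ℕ.* q) E ≋ ∏ (4 ℕ.* q) B [mod P * P ]
      stable = ∏-stable (4 ℕ.* q) B one P (+ n) denominator-slope
      h : ∀ n P → n * P ≡ P * n * + 1
      h = solve-∀
      root : ∀ i → + denominator-base p n i ≡ E i
      root i = trans (ℤP.pos-+ (suc i) (n ℕ.* p))
        (cong (λ t → + suc i + t) (trans (ℤP.pos-* n p) (h (+ n) P)))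
      denom≡ : denom p n ≡ ∏ (4 ℕ.* q) E * ∏ (4 ℕ.* q) E
      denom≡ = trans (∏-ext (4 ℕ.* q) (λ i _ → cong₂ _*_ (root i) (root i))) (∏-mul (4 ℕ.* q) E E)

  denominator-prime-to-p : ∀ n → ¬ p ∣ ℤ.∣ denom p n ∣
  denominator-prime-to-p n = ∤-∏ p-prime (4 ℕ.* q) _ (λ i i<4q → ∤-* p-prime (∤-base i i<4q) (∤-base i i<4q))
    where
      ∤-base : ∀ i → i < 4 ℕ.* q → ¬ p ∣ denominator-base p n i
      ∤-base i i<4q p∣ = ℕP.<⇒≱ (ℕ.s≤s i<4q)
        (ℕD.∣⇒≤ (ℕD.∣m+n∣m⇒∣n (subst (p ∣_) (ℕP.+-comm (suc i) (n ℕ.* p)) p∣) (ℕD.n∣m*n n)))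

  F-congruence : ∀ n m → F p n ≡ F p m [modℚ p ^ 2 ]
  F-congruence n m = fraction-congruence 2 (F p n) (F p m) p-prime (F-fraction p n) (F-fraction p m)
    (mod-p² (≋-trans (numerator-stable n) (≋-sym (numerator-stable m))))
    (mod-p² (≋-trans (denominator-stable n) (≋-sym (denominator-stable m))))
    (denominator-prime-to-p n) (denominator-prime-to-p m)
    where
      mod-p² : ∀ {a b} → a ≋ b [mod P * P ] → a ≋ b [mod + (p ^ 2) ]
      mod-p² {a} {b} = subst (λ M → a ≋ b [mod M ]) (cong (λ t → + (p ℕ.* t)) (sym (ℕP.*-identityʳ p)))

one-mod-four : ∀ p → p % 4 ≡ 1 → p ≡ suc (4 ℕ.* (p / 4))
one-mod-four p p%4≡1 = trans (ℕDM.m≡m%n+[m/n]*n p 4) (cong₂ ℕ._+_ p%4≡1 (ℕP.*-comm (p / 4) 4))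

lemma4p1 : (p : ℕ) → Prime p → p % 4 ≡ 1 →
    (n m : ℕ) → F p n ≡ F p m [modℚ p ^ 2 ]
lemma4p1 p p-prime p%4≡1 n m =
  subst (λ p → F p n ≡ F p m [modℚ p ^ 2 ]) (sym shape)
    (OneModFour.F-congruence (p / 4) (subst Prime shape p-prime) n m)
  where
    shape : p ≡ suc (4 ℕ.* (p / 4))
    shape = one-mod-four p p%4≡1
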